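{- Let $G=(V,E)$ be a graph and let $(C,R)$ be a comb of $G$. Then the induced subgraph $G[C\cup R]$ is trivially perfect. Moreover, the sets $V_p$ and $V_f$, the ordered partition $(C_1,\dots,C_l)$ of $C$ and the ordered partition $(R_1,\dots,R_l)$ of $R$ witnessing that $(C,R)$ is a comb are uniquely determined.
   Context: A graph is trivially perfect if it has no induced $P_4$ or $C_4$. $N_G(x)$ is the open neighborhood; for $S\subseteq V$, $N_G(S)=\bigcup_{v\in S}N_G[v]\setminus S$. A module is a set $M$ with $N_G(u)\setminus M=N_G(v)\setminus M$ for all $u,v\in M$; a trivially perfect module is a module $M$ with $G[M]$ trivially perfect. A critical clique is a maximal set of vertices with pairwise equal closed neighborhoods. Comb: a pair $(C,R)$ of subsets of $V$ such that $C$ is a clique partitioned into $l$ critical cliques $C_1,\dots,C_l$ of $G$, $R$ is partitioned into $l$ non-empty trivially perfect modules $R_1,\dots,R_l$ of $G$ with no edges between distinct $R_i$, and: there exist disjoint sets $V_f,V_p\subseteq V\setminus(C\cup R)$ with $V_f\neq\emptyset$ such that every $x\in C$ satisfies $N_{G\setminus(C\cup R)}(x)=V_p\cup V_f$ and every $y\in R$ satisfies $N_{G\setminus(C\cup R)}(y)=V_p$; and for every $1\le i\le l$, $N_{G[R]}(C_i)=\bigcup_{j=i}^{l}R_j$ and $N_{G[C]}(R_i)=\bigcup_{j=1}^{i}C_j$. The number $l$ is the length of the comb. -}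

module Defs where

open import Data.Nat using (ℕ; _≤_)
open import Data.Bool using (Bool; true; false)
open import Data.Fin using (Fin; toℕ)
open import Data.Fin.Subset using (Subset; _∈_; _∉_; _∪_; _⊆_)
open import Data.Product using (Σ; ∃; _×_; _,_)
open import Data.Sum using (_⊎_)
open import Data.Empty using (⊥)
open import Relation.Nullary using (¬_)
open import Relation.Binary.PropositionalEquality using (_≡_; _≢_)
open import Function.Bundles using (_⇔_)

record Graph (n : ℕ) : Set where
  field
    adj    : Fin n → Fin n → Bool
    sym    : ∀ x y → adj x y ≡ adj y x
    irrefl : ∀ x → adj x x ≡ false
open Graph public

module _ {n : ℕ} (G : Graph n) where

  E : Fin n → Fin n → Set
  E x y = adj G x y ≡ true

  InClosedNbh : Fin n → Fin n → Set
  InClosedNbh x w = w ≡ x ⊎ E x w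

  InducedP4In : Subset n → Set
  InducedP4In S = Σ (Fin n) λ a → Σ (Fin n) λ b → Σ (Fin n) λ c → Σ (Fin n) λ d →
    (a ∈ S × b ∈ S × c ∈ S × d ∈ S) ×
    (a ≢ b × a ≢ c × a ≢ d × b ≢ c × b ≢ d × c ≢ d) ×
    (E a b × E b c × E c d) × (¬ E a c × ¬ E b d × ¬ E a d)

  InducedC4In : Subset n → Set
  InducedC4In S = Σ (Fin n) λ a → Σ (Fin n) λ b → Σ (Fin n) λ c → Σ (Fin n) λ d →
    (a ∈ S × b ∈ S × c ∈ S × d ∈ S) ×
    (a ≢ b × a ≢ c × a ≢ d × b ≢ c × b ≢ d × c ≢ d) ×
    (E a b × E b c × E c d × E d a) × (¬ E a c × ¬ E b d)

  TriviallyPerfectOn : Subset n → Set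
  TriviallyPerfectOn S = ¬ InducedP4In S × ¬ InducedC4In S

  IsModule : Subset n → Set
  IsModule M = ∀ u v w → u ∈ M → v ∈ M → w ∉ M → (E u w ⇔ E v w)

  IsTPModule : Subset n → Set
  IsTPModule M = IsModule M × TriviallyPerfectOn M

  IsClique : Subset n → Set
  IsClique K = ∀ u v → u ∈ K → v ∈ K → u ≢ v → E u v

  EqualClosedNbhs : Subset n → Set
  EqualClosedNbhs S = ∀ u v → u ∈ S → v ∈ S → ∀ w → (InClosedNbh u w ⇔ InClosedNbh v w)

  IsCriticalClique : Subset n → Set
  IsCriticalClique K = EqualClosedNbhs K × (∀ S → K ⊆ S → EqualClosedNbhs S → S ⊆ K)

  IsPartitionOf : {l : ℕ} → (Fin l → Subset n) → Subset n → Set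
  IsPartitionOf {l} P S =
    (∀ i j x → x ∈ P i → x ∈ P j → i ≡ j) × (∀ x → (x ∈ S ⇔ Σ (Fin l) λ i → x ∈ P i))

  record CombWitness (C R : Subset n) : Set where
    field
      len   : ℕ
      len≥1 : 1 ≤ len
      Cs    : Fin len → Subset n
      Rs    : Fin len → Subset n
      Vp    : Subset n
      Vf    : Subset n
      C-clique    : IsClique C
      Cs-part     : IsPartitionOf Cs C
      Cs-critical : ∀ i → IsCriticalClique (Cs i)
      Rs-part     : IsPartitionOf Rs R
      Rs-nonempty : ∀ i → Σ (Fin n) λ x → x ∈ Rs i
      Rs-tpmod    : ∀ i → IsTPModule (Rs i)
      Rs-noedges  : ∀ i j x y → i ≢ j → x ∈ Rs i → y ∈ Rs j → ¬ E x y
      Vp-out  : ∀ z → z ∈ Vp → z ∉ (C ∪ R)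
      Vf-out  : ∀ z → z ∈ Vf → z ∉ (C ∪ R)
      VpVf-disj : ∀ z → z ∈ Vp → z ∉ Vf
      Vf-nonempty : Σ (Fin n) λ z → z ∈ Vf
      C-out : ∀ x → x ∈ C → ∀ z → z ∉ (C ∪ R) → (E x z ⇔ (z ∈ Vp ⊎ z ∈ Vf))
      R-out : ∀ y → y ∈ R → ∀ z → z ∉ (C ∪ R) → (E y z ⇔ z ∈ Vp)
      C-to-R : ∀ i y → ((y ∈ R × Σ (Fin n) λ x → x ∈ Cs i × E x y)
                        ⇔ (Σ (Fin len) λ j → toℕ i ≤ toℕ j × y ∈ Rs j))
      R-to-C : ∀ i x → ((x ∈ C × Σ (Fin n) λ y → y ∈ Rs i × E y x)
                        ⇔ (Σ (Fin len) λ j → toℕ j ≤ toℕ i × x ∈ Cs j))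
  open CombWitness public

  SameCombData : {C R : Subset n} → CombWitness C R → CombWitness C R → Set
  SameCombData w₁ w₂ =
    Vp w₁ ≡ Vp w₂ × Vf w₁ ≡ Vf w₂ × len w₁ ≡ len w₂ ×
    (∀ (i : Fin (len w₁)) (j : Fin (len w₂)) → toℕ i ≡ toℕ j →
        Cs w₁ i ≡ Cs w₂ j × Rs w₁ i ≡ Rs w₂ j)

{-# OPTIONS --safe #-}
-- The comb conditions say that x ∈ C i and y ∈ R j are adjacent exactly when i ≤ j,
-- that edges inside R never leave a part R j, and that C is a clique.  So the bipartite
-- graph between C and R has nested neighbourhoods, and an induced P4 or C4 in C ∪ R
-- would either need two non-adjacent vertices of C, or two crossing non-edges between
-- C and R, or lie inside a single trivially perfect module R j.
--
-- For uniqueness, the level of a vertex is intrinsic: x ∈ C has level ≥ k + 1 iff some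
-- y ∈ R that is not adjacent to x is adjacent to some x₀ ∈ C of level ≥ k, which gives
-- an induction on k; the level of y ∈ R is then the largest level of a neighbour of y in C.
-- V_p and V_f are read off from the neighbourhoods of any vertex of R and of C.
module Submission where

open import Defs hiding (sym)
open import Data.Nat using (ℕ; zero; suc; _≤_; _<_; z≤n)
open import Data.Nat.Properties
  using (≤-refl; ≤-reflexive; ≤-trans; ≤-antisym; ≤-<-trans; <-trans; <⇒≤; <⇒≱; ≰⇒>; ≮⇒≥; <-irrefl)
open import Data.Fin using (Fin; toℕ; fromℕ<; _≟_)
open import Data.Fin.Properties using (toℕ-injective; toℕ<n; toℕ-fromℕ<)
open import Data.Fin.Subset using (Subset; _∪_; _∈_; _∉_; _⊆_)
open import Data.Fin.Subset.Properties using (⊆-antisym; x∈p∪q⁻)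
open import Data.Product using (Σ; _×_; _,_; proj₁; proj₂)
open import Data.Sum using (inj₁; inj₂; [_,_]′)
open import Data.Empty using (⊥-elim)
open import Relation.Nullary using (¬_; yes; no)
open import Relation.Binary.PropositionalEquality using (_≡_; refl; sym; trans; subst)
open import Function using (id)
open import Function.Bundles using (_⇔_; mk⇔; Equivalence)
open Equivalence using (to; from)

module _ {n : ℕ} (G : Graph n) where

  E-sym : ∀ {x y} → E G x y → E G y x
  E-sym {x} {y} e = trans (sym (Graph.sym G x y)) e

  module _ {S : Subset n} {l m : ℕ} {P : Fin l → Subset n} {Q : Fin m → Subset n}
           (P-part : IsPartitionOf G P S) (Q-part : IsPartitionOf G Q S)
           (same-level : ∀ {x i j} → x ∈ P i → x ∈ Q j → toℕ i ≡ toℕ j) where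

    private
      P⇒Q : ∀ {i x} → x ∈ P i → Σ (Fin m) λ j → x ∈ Q j
      P⇒Q {i} {x} x∈Pi = to (proj₂ Q-part x) (from (proj₂ P-part x) (i , x∈Pi))

    part-⊆ : ∀ {i j} → toℕ i ≡ toℕ j → P i ⊆ Q j
    part-⊆ {i} {j} i≡j {x} x∈Pi =
      let (j′ , x∈Qj′) = P⇒Q x∈Pi
      in subst (λ k → x ∈ Q k) (toℕ-injective (trans (sym (same-level x∈Pi x∈Qj′)) i≡j)) x∈Qj′

    parts-count-≤ : (∀ i → Σ (Fin n) λ x → x ∈ P i) → l ≤ m
    parts-count-≤ P-nonempty = ≮⇒≥ λ m<l →
      let i = fromℕ< m<l
          (x , x∈Pi) = P-nonempty i
          (j , x∈Qj) = P⇒Q x∈Pi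
      in <-irrefl (trans (sym (same-level x∈Pi x∈Qj)) (toℕ-fromℕ< m<l)) (toℕ<n j)

  module Comb {C R : Subset n} (w : CombWitness G C R) where

    Cs⊆C : ∀ {i x} → x ∈ Cs w i → x ∈ C
    Cs⊆C {i} {x} x∈Ci = from (proj₂ (Cs-part w) x) (i , x∈Ci)

    Rs⊆R : ∀ {i x} → x ∈ Rs w i → x ∈ R
    Rs⊆R {i} {x} x∈Ri = from (proj₂ (Rs-part w) x) (i , x∈Ri)

    C⊆⋃Cs : ∀ {x} → x ∈ C → Σ (Fin (len w)) λ i → x ∈ Cs w i
    C⊆⋃Cs {x} = to (proj₂ (Cs-part w) x)

    R⊆⋃Rs : ∀ {x} → x ∈ R → Σ (Fin (len w)) λ i → x ∈ Rs w i
    R⊆⋃Rs {x} = to (proj₂ (Rs-part w) x)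

    -- A vertex of V_f is adjacent to every vertex of C and to no vertex of R.
    ∈C⇒∉R : ∀ {x} → x ∈ C → x ∉ R
    ∈C⇒∉R {x} x∈C x∈R =
      let (f , f∈Vf) = Vf-nonempty w
          f-out = Vf-out w f f∈Vf
          xf = from (C-out w x x∈C f f-out) (inj₂ f∈Vf)
      in VpVf-disj w f (to (R-out w x x∈R f f-out) xf) f∈Vf

    adjacent⇔level-≤ : ∀ {i j x y} → x ∈ Cs w i → y ∈ Rs w j → E G x y ⇔ (toℕ i ≤ toℕ j)
    adjacent⇔level-≤ {i} {j} {x} {y} x∈Ci y∈Rj = mk⇔ level-≤ adjacent
      where
        level-≤ : E G x y → toℕ i ≤ toℕ j
        level-≤ xy with to (C-to-R w i y) (Rs⊆R y∈Rj , x , x∈Ci , xy)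
        ... | j′ , i≤j′ , y∈Rj′ rewrite proj₁ (Rs-part w) j′ j y y∈Rj′ y∈Rj = i≤j′

        -- x shares the closed neighbourhood of the neighbour x′ of y in the critical clique C i.
        adjacent : toℕ i ≤ toℕ j → E G x y
        adjacent i≤j with from (C-to-R w i y) (j , i≤j , y∈Rj)
        ... | _ , x′ , x′∈Ci , x′y with to (proj₁ (Cs-critical w i) x′ x x′∈Ci x∈Ci y) (inj₂ x′y)
        ... | inj₂ xy = xy
        ... | inj₁ refl = ⊥-elim (∈C⇒∉R (Cs⊆C x∈Ci) (Rs⊆R y∈Rj))

    R-edge⇒same-part : ∀ {i j y y′} → y ∈ Rs w i → y′ ∈ Rs w j → E G y y′ → i ≡ j
    R-edge⇒same-part {i} {j} {y} {y′} y∈Ri y′∈Rj yy′ with i ≟ j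
    ... | yes i≡j = i≡j
    ... | no i≢j = ⊥-elim (Rs-noedges w i j y y′ i≢j y∈Ri y′∈Rj yy′)

    R-path-in-one-part : ∀ {a b c d} → a ∈ R → b ∈ R → c ∈ R → d ∈ R →
                         E G a b → E G b c → E G c d →
                         Σ (Fin (len w)) λ i → a ∈ Rs w i × b ∈ Rs w i × c ∈ Rs w i × d ∈ Rs w i
    R-path-in-one-part a∈R b∈R c∈R d∈R ab bc cd
      with R⊆⋃Rs a∈R | R⊆⋃Rs b∈R | R⊆⋃Rs c∈R | R⊆⋃Rs d∈R
    ... | i , a∈Ri | j , b∈Rj | k , c∈Rk | l , d∈Rl
      with R-edge⇒same-part a∈Ri b∈Rj ab | R-edge⇒same-part b∈Rj c∈Rk bc
         | R-edge⇒same-part c∈Rk d∈Rl cd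
    ... | refl | refl | refl = i , a∈Ri , b∈Rj , c∈Rk , d∈Rl

    adjacent-along-R-edge : ∀ {x y y′} → x ∈ C → y ∈ R → y′ ∈ R →
                            E G x y → E G y y′ → E G x y′
    adjacent-along-R-edge x∈C y∈R y′∈R xy yy′ with C⊆⋃Cs x∈C | R⊆⋃Rs y∈R | R⊆⋃Rs y′∈R
    ... | i , x∈Ci | j , y∈Rj | j′ , y′∈Rj′ with R-edge⇒same-part y∈Rj y′∈Rj′ yy′
    ... | refl = from (adjacent⇔level-≤ x∈Ci y′∈Rj′) (to (adjacent⇔level-≤ x∈Ci y∈Rj) xy)

    level-<-of-non-neighbour : ∀ {i₀ i x₀ x y} → x₀ ∈ Cs w i₀ → x ∈ Cs w i → y ∈ R →
                               E G x₀ y → ¬ E G x y → toℕ i₀ < toℕ i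
    level-<-of-non-neighbour x₀∈Ci₀ x∈Ci y∈R x₀y ¬xy =
      let (j , y∈Rj) = R⊆⋃Rs y∈R
      in ≤-<-trans (to (adjacent⇔level-≤ x₀∈Ci₀ y∈Rj) x₀y)
                   (≰⇒> λ i≤j → ¬xy (from (adjacent⇔level-≤ x∈Ci y∈Rj) i≤j))

    crossing-adjacent : ∀ {x x′ y y′} → x ∈ C → x′ ∈ C → y ∈ R → y′ ∈ R →
                        E G x y → E G x′ y′ → ¬ E G x y′ → E G x′ y
    crossing-adjacent x∈C x′∈C y∈R y′∈R xy x′y′ ¬xy′
      with C⊆⋃Cs x∈C | C⊆⋃Cs x′∈C | R⊆⋃Rs y∈R
    ... | i , x∈Ci | i′ , x′∈Ci′ | j , y∈Rj =
      from (adjacent⇔level-≤ x′∈Ci′ y∈Rj)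
        (≤-trans (<⇒≤ (level-<-of-non-neighbour x′∈Ci′ x∈Ci y′∈R x′y′ ¬xy′))
                 (to (adjacent⇔level-≤ x∈Ci y∈Rj) xy))

    no-induced-P4 : ¬ InducedP4In G (C ∪ R)
    no-induced-P4 (a , b , c , d , (a∈ , b∈ , c∈ , d∈) , distinct@(_ , a≢c , a≢d , _ , b≢d , _) ,
                   edges@(ab , bc , cd) , non-edges@(¬ac , ¬bd , ¬ad))
      with x∈p∪q⁻ C R a∈ | x∈p∪q⁻ C R b∈ | x∈p∪q⁻ C R c∈ | x∈p∪q⁻ C R d∈
    ... | inj₂ a∈R | inj₂ b∈R | inj₂ c∈R | inj₂ d∈R =
      let (i , in-Ri) = R-path-in-one-part a∈R b∈R c∈R d∈R ab bc cd
      in proj₁ (proj₂ (Rs-tpmod w i)) (a , b , c , d , in-Ri , distinct , edges , non-edges)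
    ... | inj₁ a∈C | _ | inj₁ c∈C | _ = ¬ac (C-clique w a c a∈C c∈C a≢c)
    ... | inj₁ a∈C | _ | _ | inj₁ d∈C = ¬ad (C-clique w a d a∈C d∈C a≢d)
    ... | _ | inj₁ b∈C | _ | inj₁ d∈C = ¬bd (C-clique w b d b∈C d∈C b≢d)
    ... | inj₁ a∈C | inj₂ b∈R | inj₂ c∈R | _ = ¬ac (adjacent-along-R-edge a∈C b∈R c∈R ab bc)
    ... | _ | inj₁ b∈C | inj₂ c∈R | inj₂ d∈R = ¬bd (adjacent-along-R-edge b∈C c∈R d∈R bc cd)
    ... | inj₂ a∈R | inj₂ b∈R | inj₁ c∈C | _ =
      ¬ac (E-sym (adjacent-along-R-edge c∈C b∈R a∈R (E-sym bc) (E-sym ab)))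
    ... | _ | inj₂ b∈R | inj₂ c∈R | inj₁ d∈C =
      ¬bd (E-sym (adjacent-along-R-edge d∈C c∈R b∈R (E-sym cd) (E-sym bc)))
    ... | inj₂ a∈R | inj₁ b∈C | inj₁ c∈C | inj₂ d∈R =
      ¬ac (E-sym (crossing-adjacent b∈C c∈C a∈R d∈R (E-sym ab) cd ¬bd))

    no-induced-C4 : ¬ InducedC4In G (C ∪ R)
    no-induced-C4 (a , b , c , d , (a∈ , b∈ , c∈ , d∈) , distinct@(_ , a≢c , _ , _ , b≢d , _) ,
                   edges@(ab , bc , cd , da) , non-edges@(¬ac , ¬bd))
      with x∈p∪q⁻ C R a∈ | x∈p∪q⁻ C R b∈ | x∈p∪q⁻ C R c∈ | x∈p∪q⁻ C R d∈
    ... | inj₂ a∈R | inj₂ b∈R | inj₂ c∈R | inj₂ d∈R =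
      let (i , in-Ri) = R-path-in-one-part a∈R b∈R c∈R d∈R ab bc cd
      in proj₂ (proj₂ (Rs-tpmod w i)) (a , b , c , d , in-Ri , distinct , edges , non-edges)
    ... | inj₁ a∈C | _ | inj₁ c∈C | _ = ¬ac (C-clique w a c a∈C c∈C a≢c)
    ... | _ | inj₁ b∈C | _ | inj₁ d∈C = ¬bd (C-clique w b d b∈C d∈C b≢d)
    ... | inj₁ a∈C | inj₂ b∈R | inj₂ c∈R | _ = ¬ac (adjacent-along-R-edge a∈C b∈R c∈R ab bc)
    ... | _ | inj₁ b∈C | inj₂ c∈R | inj₂ d∈R = ¬bd (adjacent-along-R-edge b∈C c∈R d∈R bc cd)
    ... | inj₂ a∈R | _ | inj₁ c∈C | inj₂ d∈R = ¬ac (E-sym (adjacent-along-R-edge c∈C d∈R a∈R cd da))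
    ... | inj₂ a∈R | inj₂ b∈R | _ | inj₁ d∈C = ¬bd (E-sym (adjacent-along-R-edge d∈C a∈R b∈R da ab))

    trivially-perfect : TriviallyPerfectOn G (C ∪ R)
    trivially-perfect = no-induced-P4 , no-induced-C4

    Cs-nonempty : ∀ i → Σ (Fin n) λ x → x ∈ Cs w i
    Cs-nonempty i =
      let (y , y∈Ri) = Rs-nonempty w i
          (_ , x , x∈Ci , _) = from (C-to-R w i y) (i , ≤-refl , y∈Ri)
      in x , x∈Ci

    C-nonempty : Σ (Fin n) λ x → x ∈ C
    C-nonempty = let (x , x∈C₀) = Cs-nonempty (fromℕ< (len≥1 w)) in x , Cs⊆C x∈C₀

    R-nonempty : Σ (Fin n) λ y → y ∈ R
    R-nonempty = let (y , y∈R₀) = Rs-nonempty w (fromℕ< (len≥1 w)) in y , Rs⊆R y∈R₀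

  module _ {C R : Subset n} where
    open Comb

    C-level-lower-bound : ∀ (w w′ : CombWitness G C R) k {x i j} → x ∈ Cs w i → x ∈ Cs w′ j →
                          k ≤ toℕ i → k ≤ toℕ j
    C-level-lower-bound w w′ zero _ _ _ = z≤n
    C-level-lower-bound w w′ (suc k) {x} {i} {j} x∈Ci x∈C′j k<i =
      let k̂ = fromℕ< (<-trans k<i (toℕ<n i))
          (y , y∈Rk̂) = Rs-nonempty w k̂
          (x₀ , x₀∈Ck̂) = Cs-nonempty w k̂
          (j₀ , x₀∈C′j₀) = C⊆⋃Cs w′ (Cs⊆C w x₀∈Ck̂)
          x₀y = from (adjacent⇔level-≤ w x₀∈Ck̂ y∈Rk̂) ≤-refl
          ¬xy = λ xy → <⇒≱ k<i (≤-trans (to (adjacent⇔level-≤ w x∈Ci y∈Rk̂) xy)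
                                        (≤-reflexive (toℕ-fromℕ< _)))
      in ≤-<-trans (C-level-lower-bound w w′ k x₀∈Ck̂ x₀∈C′j₀ (≤-reflexive (sym (toℕ-fromℕ< _))))
                   (level-<-of-non-neighbour w′ x₀∈C′j₀ x∈C′j (Rs⊆R w y∈Rk̂) x₀y ¬xy)

    C-level-≡ : ∀ (w w′ : CombWitness G C R) {x i j} → x ∈ Cs w i → x ∈ Cs w′ j → toℕ i ≡ toℕ j
    C-level-≡ w w′ x∈Ci x∈C′j =
      ≤-antisym (C-level-lower-bound w w′ _ x∈Ci x∈C′j ≤-refl)
                (C-level-lower-bound w′ w _ x∈C′j x∈Ci ≤-refl)

    R-level-≤ : ∀ (w w′ : CombWitness G C R) {y i j} → y ∈ Rs w i → y ∈ Rs w′ j → toℕ i ≤ toℕ j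
    R-level-≤ w w′ {i = i} y∈Ri y∈R′j =
      let (x , x∈Ci) = Cs-nonempty w i
          (j₀ , x∈C′j₀) = C⊆⋃Cs w′ (Cs⊆C w x∈Ci)
          xy = from (adjacent⇔level-≤ w x∈Ci y∈Ri) ≤-refl
      in subst (_≤ _) (sym (C-level-≡ w w′ x∈Ci x∈C′j₀)) (to (adjacent⇔level-≤ w′ x∈C′j₀ y∈R′j) xy)

    R-level-≡ : ∀ (w w′ : CombWitness G C R) {y i j} → y ∈ Rs w i → y ∈ Rs w′ j → toℕ i ≡ toℕ j
    R-level-≡ w w′ y∈Ri y∈R′j = ≤-antisym (R-level-≤ w w′ y∈Ri y∈R′j) (R-level-≤ w′ w y∈R′j y∈Ri)

    Vp-⊆ : ∀ (w w′ : CombWitness G C R) → Vp w ⊆ Vp w′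
    Vp-⊆ w w′ {z} z∈Vp =
      let (y , y∈R) = R-nonempty w
          z-out = Vp-out w z z∈Vp
      in to (R-out w′ y y∈R z z-out) (from (R-out w y y∈R z z-out) z∈Vp)

    Vf-⊆ : ∀ (w w′ : CombWitness G C R) → Vf w ⊆ Vf w′
    Vf-⊆ w w′ {z} z∈Vf =
      let (x , x∈C) = C-nonempty w
          z-out = Vf-out w z z∈Vf
          xz = from (C-out w x x∈C z z-out) (inj₂ z∈Vf)
      in [ (λ z∈Vp′ → ⊥-elim (VpVf-disj w z (Vp-⊆ w′ w z∈Vp′) z∈Vf)) , id ]′
           (to (C-out w′ x x∈C z z-out) xz)

    comb-data-unique : ∀ (w₁ w₂ : CombWitness G C R) → SameCombData G w₁ w₂
    comb-data-unique w₁ w₂ =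
      ⊆-antisym (Vp-⊆ w₁ w₂) (Vp-⊆ w₂ w₁) ,
      ⊆-antisym (Vf-⊆ w₁ w₂) (Vf-⊆ w₂ w₁) ,
      ≤-antisym (parts-count-≤ (Cs-part w₁) (Cs-part w₂) (C-level-≡ w₁ w₂) (Cs-nonempty w₁))
                (parts-count-≤ (Cs-part w₂) (Cs-part w₁) (C-level-≡ w₂ w₁) (Cs-nonempty w₂)) ,
      λ i j i≡j →
        ⊆-antisym (part-⊆ (Cs-part w₁) (Cs-part w₂) (C-level-≡ w₁ w₂) i≡j)
                  (part-⊆ (Cs-part w₂) (Cs-part w₁) (C-level-≡ w₂ w₁) (sym i≡j)) ,
        ⊆-antisym (part-⊆ (Rs-part w₁) (Rs-part w₂) (R-level-≡ w₁ w₂) i≡j)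
                  (part-⊆ (Rs-part w₂) (Rs-part w₁) (R-level-≡ w₂ w₁) (sym i≡j))

proposition10 : ∀ {n : ℕ} (G : Graph n) (C R : Subset n) → CombWitness G C R →
    TriviallyPerfectOn G (C ∪ R) × (∀ (w₁ w₂ : CombWitness G C R) → SameCombData G w₁ w₂)
proposition10 G C R w = Comb.trivially-perfect G w , comb-data-unique G
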